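{- Let $H$ be a Heyting algebra and $a,b,c,x \in H$. Then $j_{a,b}(x) = j_{a,c}(x)$ if and only if $x \to a \leq (b \to c) \land (c \to b)$. In particular, if $b \leq c \leq x \leq a \to b$, then $j_{a,b}(x) = j_{a,c}(x)$.
   Context: For $a,b$ in a Heyting algebra $H$, the almost-topology $j_{a,b} : H \to H$ is defined by $j_{a,b}(x) = (x \to a) \to b$. -}

module Defs where

open import Level using (Level)
open import Relation.Binary.Lattice.Bundles using (HeytingAlgebra)

j : ∀ {c ℓ₁ ℓ₂ : Level} (H : HeytingAlgebra c ℓ₁ ℓ₂) →
    HeytingAlgebra.Carrier H → HeytingAlgebra.Carrier H →
    HeytingAlgebra.Carrier H → HeytingAlgebra.Carrier H
j H a b x = (x ⇨ a) ⇨ b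
  where open HeytingAlgebra H

-- Everything reduces to one fact about a Heyting algebra: y ⇨ b ≤ y ⇨ c holds
-- exactly when y ≤ b ⇨ c. Taking y = x ⇨ a, the two almost-topologies agree at
-- x iff x ⇨ a lies below both b ⇨ c and c ⇨ b. Under b ≤ c ≤ x ≤ a ⇨ b the
-- first bound is immediate, and the second holds because x ⇨ a together with c
-- yields a (as c ≤ x) and a ⇨ b (as c ≤ x ≤ a ⇨ b), hence b.
module Submission where

open import Defs
open import Data.Product using (_×_; _,_)
open import Function.Base using (_$_)
open import Function.Bundles using (_⇔_; mk⇔; Equivalence)
open import Relation.Binary.Lattice.Bundles using (HeytingAlgebra)
import Relation.Binary.Lattice.Properties.HeytingAlgebra as HeytingAlgebraProperties

module _ {o ℓ₁ ℓ₂} (H : HeytingAlgebra o ℓ₁ ℓ₂) where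
  open HeytingAlgebra H
  open HeytingAlgebraProperties H using (⇨-eval; ⇨-applyˡ; y≤x⇨y)

  ≤-⇨⇒⇨-≤-⇨ : ∀ {y b c} → y ≤ b ⇨ c → y ⇨ b ≤ y ⇨ c
  ≤-⇨⇒⇨-≤-⇨ y≤b⇨c = transpose-⇨ $
    trans (∧-greatest (x∧y≤y _ _) ⇨-eval) (transpose-∧ y≤b⇨c)

  ⇨-≤-⇨⇒≤-⇨ : ∀ {y b c} → y ⇨ b ≤ y ⇨ c → y ≤ b ⇨ c
  ⇨-≤-⇨⇒≤-⇨ y⇨b≤y⇨c = transpose-⇨ $
    trans (∧-greatest (trans (x∧y≤y _ _) (trans y≤x⇨y y⇨b≤y⇨c)) (x∧y≤x _ _)) ⇨-eval

  ⇨-≈-⇨⇔≤-⇨∧⇨ : ∀ {y b c} → (y ⇨ b ≈ y ⇨ c) ⇔ (y ≤ (b ⇨ c) ∧ (c ⇨ b))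
  ⇨-≈-⇨⇔≤-⇨∧⇨ = mk⇔
    (λ eq → ∧-greatest (⇨-≤-⇨⇒≤-⇨ (reflexive eq)) (⇨-≤-⇨⇒≤-⇨ (reflexive (Eq.sym eq))))
    (λ y≤⇨∧⇨ → antisym (≤-⇨⇒⇨-≤-⇨ (trans y≤⇨∧⇨ (x∧y≤x _ _)))
                         (≤-⇨⇒⇨-≤-⇨ (trans y≤⇨∧⇨ (x∧y≤y _ _))))

  chain⇒⇨≤⇨∧⇨ : ∀ {a b c x} → b ≤ c → c ≤ x → x ≤ a ⇨ b →
            x ⇨ a ≤ (b ⇨ c) ∧ (c ⇨ b)
  chain⇒⇨≤⇨∧⇨ {a} {b} {c} {x} b≤c c≤x x≤a⇨b = ∧-greatest
    (transpose-⇨ (trans (x∧y≤y _ _) b≤c))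
    (transpose-⇨ (trans (∧-greatest yields-a⇨b yields-a) ⇨-eval))
    where
    yields-a⇨b : (x ⇨ a) ∧ c ≤ a ⇨ b
    yields-a⇨b = trans (x∧y≤y _ _) (trans c≤x x≤a⇨b)
    yields-a : (x ⇨ a) ∧ c ≤ a
    yields-a = ⇨-applyˡ c≤x

lemma8p5 : ∀ {c ℓ₁ ℓ₂} (H : HeytingAlgebra c ℓ₁ ℓ₂) →
    let open HeytingAlgebra H in
    ∀ (a b c x : Carrier) →
    ((j H a b x ≈ j H a c x) ⇔ ((x ⇨ a) ≤ ((b ⇨ c) ∧ (c ⇨ b))))
    × (b ≤ c → c ≤ x → x ≤ (a ⇨ b) → j H a b x ≈ j H a c x)
lemma8p5 H a b c x =
    ⇨-≈-⇨⇔≤-⇨∧⇨ H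
  , λ b≤c c≤x x≤a⇨b → Equivalence.from (⇨-≈-⇨⇔≤-⇨∧⇨ H) (chain⇒⇨≤⇨∧⇨ H b≤c c≤x x≤a⇨b)
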